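{- Let $\Gamma$ be a finite set of implicational formulas and $A$ an implicational formula. The sequent $\Gamma\vdash A$ is derivable in (implicational) minimal logic if and only if the judgment $\Gamma^{\mathsf p}\vdash A^{\mathsf p}$ is derivable in the system $\mathsf{mT}$.
   Context: Formulas are implicational: $A::=X\mid A\to A$, with $X$ ranging over propositional atoms. Minimal logic is the intuitionistic implicational logic (the type system of the simply typed $\lambda$-calculus). For each formula $A$ there are a proof formula $A^{\mathsf p}$ and a test formula $A^{\mathsf t}$; for a set $\Gamma=\{A_1,\dots,A_n\}$, $\Gamma^{\mathsf p}=\{A_1^{\mathsf p},\dots,A_n^{\mathsf p}\}$. Judgments of $\mathsf{mT}$ have the form $\Gamma^{\mathsf p},\Theta\vdash\alpha$, where $\Gamma^{\mathsf p}$ is a set of proof formulas, $\Theta$ is empty or a single test formula, and $\alpha$ is empty, a proof formula or a test formula. The rules of $\mathsf{mT}$ (in each rule $\Gamma^{\mathsf p}$ denotes an arbitrary set of proof formulas) are: - Axioms: $\Gamma^{\mathsf p},A^{\mathsf p}\vdash A^{\mathsf p}$ and $\Gamma^{\mathsf p},A^{\mathsf t}\vdash A^{\mathsf t}$. - From $\Gamma^{\mathsf p},A^{\mathsf p},B^{\mathsf t}\vdash$ infer $\Gamma^{\mathsf p}\vdash(A\to B)^{\mathsf p}$. - From $\Gamma^{\mathsf p}\vdash A^{\mathsf p}$ and $\Gamma^{\mathsf p},C^{\mathsf t}\vdash B^{\mathsf t}$ infer $\Gamma^{\mathsf p},C^{\mathsf t}\vdash(A\to B)^{\mathsf t}$.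 - From $\Gamma^{\mathsf p},A^{\mathsf t}\vdash$ infer $\Gamma^{\mathsf p}\vdash A^{\mathsf p}$. - From $\Gamma^{\mathsf p},A^{\mathsf p},B^{\mathsf t}\vdash$ infer $\Gamma^{\mathsf p},B^{\mathsf t}\vdash A^{\mathsf t}$. - From $\Gamma^{\mathsf p},B^{\mathsf t}\vdash A^{\mathsf t}$ and $\Gamma^{\mathsf p}\vdash A^{\mathsf p}$ infer $\Gamma^{\mathsf p},B^{\mathsf t}\vdash$. -}

module Defs where

open import Data.Nat using (ℕ)
open import Data.List using (List; _∷_)
open import Data.List.Membership.Propositional using (_∈_)
open import Data.Maybe using (Maybe; just; nothing)

data Formula : Set where
  atom : ℕ → Formula
  _⇒_  : Formula → Formula → Formula

infixr 5 _⇒_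

-- Finite sets of formulas represented as lists (membership-based, so
-- order and duplicates are irrelevant).
Ctx : Set
Ctx = List Formula

data _⊢m_ : Ctx → Formula → Set where
  ax  : ∀ {Γ A} → A ∈ Γ → Γ ⊢m A
  ⇒I  : ∀ {Γ A B} → (A ∷ Γ) ⊢m B → Γ ⊢m (A ⇒ B)
  ⇒E  : ∀ {Γ A B} → Γ ⊢m (A ⇒ B) → Γ ⊢m A → Γ ⊢m B

infix 3 _⊢m_

-- A judgment Γᵖ, Θ ⊢ α has:
--   Γ : Ctx                the set of formulas whose proof formulas Γᵖ appear,
--   Θ : Maybe Formula      empty, or a single test formula Cᵗ (just C),
--   α : Succ               empty, a proof formula Aᵖ, or a test formula Aᵗ.
data Succ : Set where
  ∅   : Succ
  _ᵖ  : Formula → Succ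
  _ᵗ  : Formula → Succ

data mT : Ctx → Maybe Formula → Succ → Set where
  axp  : ∀ {Γ A} → A ∈ Γ → mT Γ nothing (A ᵖ)
  axt  : ∀ {Γ A} → mT Γ (just A) (A ᵗ)
  ⇒p   : ∀ {Γ A B} → mT (A ∷ Γ) (just B) ∅ → mT Γ nothing ((A ⇒ B) ᵖ)
  ⇒t   : ∀ {Γ A B C} → mT Γ nothing (A ᵖ) → mT Γ (just C) (B ᵗ)
       → mT Γ (just C) ((A ⇒ B) ᵗ)
  tp   : ∀ {Γ A} → mT Γ (just A) ∅ → mT Γ nothing (A ᵖ)
  pt   : ∀ {Γ A B} → mT (A ∷ Γ) (just B) ∅ → mT Γ (just B) (A ᵗ)
  cut  : ∀ {Γ A B} → mT Γ (just B) (A ᵗ) → mT Γ nothing (A ᵖ)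
       → mT Γ (just B) ∅

-- Read the test formula Cᵗ on the left as the goal C, a test formula Aᵗ on the
-- right as an extra hypothesis A, and the empty succedent as "C is proved".
-- Under this reading every rule of mT is admissible in natural deduction:
-- test-to-proof and proof-to-test become identities, cut becomes a β-redex and
-- the test rule for → becomes the sequent-calculus left rule.  Conversely,
-- ⇒I and ⇒E are simulated in mT by cutting against the test axiom.
module Submission where

open import Defs
open import Data.Maybe using (Maybe; nothing; just)
open import Data.List using (_∷_)
open import Data.List.Membership.Propositional using (_∈_)
open import Data.List.Relation.Unary.Any using (here; there)
open import Data.Unit using (⊤)
open import Function.Bundles using (_⇔_; mk⇔)
open import Relation.Binary.PropositionalEquality using (refl)

rename : ∀ {Γ Δ A} → (∀ {B} → B ∈ Γ → B ∈ Δ) → Γ ⊢m A → Δ ⊢m A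
rename ρ (ax x)   = ax (ρ x)
rename ρ (⇒I d)   = ⇒I (rename ρ′ d)
  where
  ρ′ : ∀ {B C} → B ∈ C ∷ _ → B ∈ C ∷ _
  ρ′ (here p)  = here p
  ρ′ (there x) = there (ρ x)
rename ρ (⇒E d e) = ⇒E (rename ρ d) (rename ρ e)

weaken : ∀ {Γ A B} → Γ ⊢m A → (B ∷ Γ) ⊢m A
weaken = rename there

cut-⊢m : ∀ {Γ A C} → (A ∷ Γ) ⊢m C → Γ ⊢m A → Γ ⊢m C
cut-⊢m d e = ⇒E (⇒I d) e

⇒-left : ∀ {Γ A B C} → Γ ⊢m A → (B ∷ Γ) ⊢m C → ((A ⇒ B) ∷ Γ) ⊢m C
⇒-left a b = ⇒E (weaken (⇒I b)) (⇒E (ax (here refl)) (weaken a))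

-- The shapes sent to ⊤ are exactly those no rule of mT concludes.
⟦_⟧ : Ctx → Maybe Formula → Succ → Set
⟦ Γ ⟧ nothing  (A ᵖ) = Γ ⊢m A
⟦ Γ ⟧ (just C) (A ᵗ) = (A ∷ Γ) ⊢m C
⟦ Γ ⟧ (just C) ∅     = Γ ⊢m C
⟦ Γ ⟧ _        _     = ⊤

mT-sound : ∀ {Γ Θ α} → mT Γ Θ α → ⟦ Γ ⟧ Θ α
mT-sound (axp x)   = ax x
mT-sound axt       = ax (here refl)
mT-sound (⇒p d)    = ⇒I (mT-sound d)
mT-sound (⇒t a b)  = ⇒-left (mT-sound a) (mT-sound b)
mT-sound (tp d)    = mT-sound d
mT-sound (pt d)    = mT-sound d
mT-sound (cut d a) = cut-⊢m (mT-sound d) (mT-sound a)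

mT-complete : ∀ {Γ A} → Γ ⊢m A → mT Γ nothing (A ᵖ)
mT-complete (ax x)   = axp x
mT-complete (⇒I d)   = ⇒p (cut axt (mT-complete d))
mT-complete (⇒E d e) = tp (cut (⇒t (mT-complete e) axt) (mT-complete d))

proposition2 : (Γ : Ctx) (A : Formula) → (Γ ⊢m A) ⇔ mT Γ nothing (A ᵖ)
proposition2 Γ A = mk⇔ mT-complete mT-sound
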